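{- Let $\gamma \geq 2$ and $n \geq 3\gamma$ be integers. Let $\mathcal{G}_{n,\gamma}$ be the set of all simple graphs without isolated vertices having order $n$, domination number $\gamma$, and exactly one minimum dominating set. Then there exists a perfectly dominated graph $G \in \mathcal{G}_{n,\gamma}$ with exactly $$\binom{n-\gamma}{2} - \gamma(\gamma-2)$$ edges.
   Context: A dominating set of a graph $G=(V,E)$ is a set $D\subseteq V$ such that every vertex of $V\setminus D$ is adjacent to some vertex of $D$; the domination number $\gamma(G)$ is the minimum size of a dominating set, and a minimum dominating set is one of size $\gamma(G)$. A simple graph $G$ without isolated vertices, of order $n$ and domination number $\gamma$, is perfectly dominated if it has a minimum dominating set $D$ with $\sum_{x\in D}\deg(x) = n-\gamma$ (equivalently, $D$ is independent and every vertex outside $D$ is adjacent to exactly one vertex of $D$). -}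

module Defs where

open import Data.Nat using (ℕ; zero; suc; _+_; _∸_; _≤_; _<ᵇ_)
open import Data.Bool using (Bool; true; false; if_then_else_; _∧_)
open import Data.Fin using (Fin; zero; suc; toℕ)
open import Data.Fin.Subset using (Subset; _∈_; _∉_; ∣_∣)
open import Data.Vec using (lookup)
open import Data.Product using (Σ; ∃; _×_)
open import Relation.Binary.PropositionalEquality using (_≡_)

record Graph (n : ℕ) : Set where
  field
    adj    : Fin n → Fin n → Bool
    symm   : ∀ i j → adj i j ≡ adj j i
    irrefl : ∀ i → adj i i ≡ false
open Graph public

sumF : ∀ {n} → (Fin n → ℕ) → ℕ
sumF {zero}  f = 0
sumF {suc n} f = f zero + sumF (λ i → f (suc i))

countF : ∀ {n} → (Fin n → Bool) → ℕ
countF f = sumF (λ i → if f i then 1 else 0)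

degree : ∀ {n} → Graph n → Fin n → ℕ
degree G i = countF (adj G i)

edgeCount : ∀ {n} → Graph n → ℕ
edgeCount G = sumF (λ i → countF (λ j → (toℕ i <ᵇ toℕ j) ∧ adj G i j))

NoIsolated : ∀ {n} → Graph n → Set
NoIsolated G = ∀ i → ∃ λ j → adj G i j ≡ true

Dominating : ∀ {n} → Graph n → Subset n → Set
Dominating G D = ∀ v → v ∉ D → ∃ λ u → u ∈ D × adj G u v ≡ true

IsDominationNumber : ∀ {n} → Graph n → ℕ → Set
IsDominationNumber G γ =
  (∃ λ D → Dominating G D × ∣ D ∣ ≡ γ) × (∀ D → Dominating G D → γ ≤ ∣ D ∣)

IsMinDom : ∀ {n} → Graph n → ℕ → Subset n → Set
IsMinDom G γ D = Dominating G D × ∣ D ∣ ≡ γ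

degSum : ∀ {n} → Graph n → Subset n → ℕ
degSum G D = sumF (λ x → if lookup D x then degree G x else 0)

PerfectlyDominated : ∀ {n} → Graph n → Set
PerfectlyDominated {n} G = NoIsolated G ×
  (∃ λ γ → IsDominationNumber G γ ×
     (∃ λ D → IsMinDom G γ D × degSum G D ≡ n ∸ γ))

InClass : (n γ : ℕ) → Graph n → Set
InClass n γ G = NoIsolated G × IsDominationNumber G γ ×
  (∀ D D′ → IsMinDom G γ D → IsMinDom G γ D′ → D ≡ D′)

{-# OPTIONS --safe #-}
-- The graph has vertex classes 0, …, γ-1: class k holds a hub hₖ, a link bₖ and a clique
-- vertex cₖ, and class 0 also holds the n - 3γ spare vertices as further copies of c₀.  The
-- clique vertices form a clique, hₖ is adjacent to the rest of its class, and bₖ to cₗ for l < k.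
-- Since N[hₖ] lies in class k, every dominating set meets every class; so γ(G) = γ and a minimum
-- dominating set S has one vertex per class.  S contains no clique vertex (for the least cₗ in S,
-- bₗ could only be dominated by some cⱼ with j < l), hence no link either (for the largest bₖ in S,
-- cₖ could only be dominated by some bⱼ with j > k), so S is the set of hubs.  The hubs form a
-- perfect code, so their degrees add up to n - γ.  Among the n - γ non-hubs the missing edges are
-- the link pairs and the pairs bₖcₗ with l ≥ k, γ² + (n - 3γ) of them; adding the n - γ hub edges
-- gives (n - γ choose 2) - γ(γ - 2) edges.
module Submission where

open import Defs
open import Data.Nat using (ℕ; _∸_; _*_; _≤_)
open import Data.Nat.Combinatorics using (_C_)
open import Data.Product using (Σ; _×_)
open import Relation.Binary.PropositionalEquality using (_≡_)

open import Data.Bool using (Bool; true; false; if_then_else_; _∧_)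
open import Data.Bool.Properties using (T-≡; ¬-not)
open import Data.Empty using (⊥-elim)
open import Data.Fin using (Fin; zero; suc; toℕ; fromℕ<)
open import Data.Fin.Properties as Fin using (toℕ-injective; toℕ-fromℕ<; toℕ<n)
open import Data.Fin.Subset using (Subset; _∈_; _⊆_; ∣_∣)
open import Data.Fin.Subset.Properties using (_∈?_; ⊆-antisym)
open import Data.Nat using (zero; suc; _+_; _<_; _≡ᵇ_; _<ᵇ_; z≤n; s≤s)
open import Data.Nat.Combinatorics using (nC1≡n; nCk+nC[k+1]≡[n+1]C[k+1])
open import Data.Nat.Induction using (<-rec)
open import Data.Nat.Properties
open import Algebra.Properties.CommutativeSemigroup +-commutativeSemigroup using (interchange)
open import Data.Nat.Tactic.RingSolver using (solve-∀)
open import Data.Product using (∃; _,_; proj₁; proj₂)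
open import Data.Sum using (inj₁; inj₂)
open import Data.Vec using (Vec; []; _∷_; _++_; lookup; map)
open import Data.Vec.Properties using (lookup-map; []=⇒lookup; lookup⇒[]=)
open import Function using (_∘_; Equivalence)
open import Relation.Binary.PropositionalEquality
  using (refl; sym; trans; cong; cong₂; subst; subst₂; _≢_; module ≡-Reasoning)
open import Relation.Nullary using (yes; no; contradiction)

open Equivalence using (to; from)

≡ᵇ-complete : ∀ {m n} → m ≡ n → (m ≡ᵇ n) ≡ true
≡ᵇ-complete {m} {n} = T-≡ .to ∘ ≡⇒≡ᵇ m n

≡ᵇ-refl : ∀ m → (m ≡ᵇ m) ≡ true
≡ᵇ-refl m = ≡ᵇ-complete {m} refl

≡ᵇ-sound : ∀ {m n} → (m ≡ᵇ n) ≡ true → m ≡ n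
≡ᵇ-sound {m} {n} = ≡ᵇ⇒≡ m n ∘ T-≡ .from

≡ᵇ-false : ∀ {m n} → m ≢ n → (m ≡ᵇ n) ≡ false
≡ᵇ-false m≢n = ¬-not (m≢n ∘ ≡ᵇ-sound)

<ᵇ-sound : ∀ {m n} → (m <ᵇ n) ≡ true → m < n
<ᵇ-sound {m} {n} = <ᵇ⇒< m n ∘ T-≡ .from

<ᵇ-complete : ∀ {m n} → m < n → (m <ᵇ n) ≡ true
<ᵇ-complete = T-≡ .to ∘ <⇒<ᵇ

<ᵇ-false : ∀ {m n} → n ≤ m → (m <ᵇ n) ≡ false
<ᵇ-false n≤m = ¬-not (≤⇒≯ n≤m ∘ <ᵇ-sound)

∧-true : ∀ {a b} → a ≡ true → b ≡ true → a ∧ b ≡ true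
∧-true refl b = b

∧-true⁻ : ∀ a {b} → a ∧ b ≡ true → a ≡ true × b ≡ true
∧-true⁻ true b = refl , b

sumF-cong : ∀ {n} {f g : Fin n → ℕ} → (∀ i → f i ≡ g i) → sumF f ≡ sumF g
sumF-cong {zero}  eq = refl
sumF-cong {suc n} eq = cong₂ _+_ (eq zero) (sumF-cong (eq ∘ suc))

sumF-+ : ∀ {n} (f g : Fin n → ℕ) → sumF (λ i → f i + g i) ≡ sumF f + sumF g
sumF-+ {zero}  f g = refl
sumF-+ {suc n} f g = trans (cong (f zero + g zero +_) (sumF-+ (f ∘ suc) (g ∘ suc)))
                           (interchange (f zero) (g zero) _ _)

sumF-zero : ∀ {n} → sumF {n} (λ _ → 0) ≡ 0
sumF-zero {zero}  = refl
sumF-zero {suc n} = sumF-zero {n}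

sumF-one : ∀ {n} → sumF {n} (λ _ → 1) ≡ n
sumF-one {zero}  = refl
sumF-one {suc n} = cong suc sumF-one

sumF-comm : ∀ {m n} (f : Fin m → Fin n → ℕ) →
            sumF (λ i → sumF (f i)) ≡ sumF (λ j → sumF (λ i → f i j))
sumF-comm {zero} {n} f = sym (sumF-zero {n})
sumF-comm {suc m} f = trans (cong (sumF (f zero) +_) (sumF-comm (f ∘ suc)))
                            (sym (sumF-+ (f zero) _))

sumF-mono-≤ : ∀ {n} {f g : Fin n → ℕ} → (∀ i → f i ≤ g i) → sumF f ≤ sumF g
sumF-mono-≤ {zero}  le = z≤n
sumF-mono-≤ {suc n} le = +-mono-≤ (le zero) (sumF-mono-≤ (le ∘ suc))

sumF-mono-≤-≡ : ∀ {n} {f g : Fin n → ℕ} → (∀ i → f i ≤ g i) → sumF f ≡ sumF g →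
                ∀ i → f i ≡ g i
sumF-mono-≤-≡ {suc n} {f} {g} le eq = pointwise
  where
  open ≤-Reasoning
  head : f zero ≡ g zero
  head = ≤-antisym (le zero) (+-cancelʳ-≤ (sumF (f ∘ suc)) _ _ (begin
    g zero + sumF (f ∘ suc)  ≤⟨ +-monoʳ-≤ (g zero) (sumF-mono-≤ (le ∘ suc)) ⟩
    g zero + sumF (g ∘ suc)  ≡⟨ eq ⟨
    f zero + sumF (f ∘ suc)  ∎))
  tail : sumF (f ∘ suc) ≡ sumF (g ∘ suc)
  tail = +-cancelˡ-≡ (f zero) _ _ (trans eq (cong (_+ sumF (g ∘ suc)) (sym head)))
  pointwise : ∀ i → f i ≡ g i
  pointwise zero    = head
  pointwise (suc i) = sumF-mono-≤-≡ (le ∘ suc) tail i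

countF-∧ : ∀ {n} b (f : Fin n → Bool) → countF (λ i → b ∧ f i) ≡ (if b then countF f else 0)
countF-∧ true  f = refl
countF-∧ {n} false f = sumF-zero {n}

countF-pos : ∀ {n} (f : Fin n → Bool) {i} → f i ≡ true → 1 ≤ countF f
countF-pos f {zero}  fi rewrite fi = s≤s z≤n
countF-pos f {suc i} fi = ≤-trans (countF-pos (f ∘ suc) fi) (m≤n+m _ _)

countF-witness : ∀ {n} (f : Fin n → Bool) → 1 ≤ countF f → ∃ λ i → f i ≡ true
countF-witness {suc n} f pos with f zero in e
... | true  = zero , e
... | false = let i , fi = countF-witness (f ∘ suc) pos in suc i , fi

countF-none : ∀ {n} (f : Fin n → Bool) → (∀ i → f i ≢ true) → countF f ≡ 0
countF-none {zero}  f none = refl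
countF-none {suc n} f none with f zero in e
... | true  = ⊥-elim (none zero e)
... | false = countF-none (f ∘ suc) (none ∘ suc)

countF-single : ∀ {n} (f : Fin n → Bool) {i} → f i ≡ true → (∀ j → f j ≡ true → j ≡ i) →
                countF f ≡ 1
countF-single f {zero} fi only rewrite fi =
  cong suc (countF-none (f ∘ suc) (λ j fj → Fin.0≢1+n (sym (only (suc j) fj))))
countF-single f {suc i} fi only with f zero in e
... | true  = contradiction (only zero e) Fin.0≢1+n
... | false = countF-single (f ∘ suc) fi (λ j fj → Fin.suc-injective (only (suc j) fj))

countF≡1⇒unique : ∀ {n} (f : Fin n → Bool) → countF f ≡ 1 →
                  ∀ {i j} → f i ≡ true → f j ≡ true → i ≡ j
countF≡1⇒unique f one {zero}  {zero}  fi fj = refl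
countF≡1⇒unique f one {zero}  {suc j} fi fj rewrite fi =
  ⊥-elim (<⇒≢ (countF-pos (f ∘ suc) fj) (sym (suc-injective one)))
countF≡1⇒unique f one {suc i} {zero}  fi fj rewrite fj =
  ⊥-elim (<⇒≢ (countF-pos (f ∘ suc) fi) (sym (suc-injective one)))
countF≡1⇒unique f one {suc i} {suc j} fi fj with f zero
... | true  = ⊥-elim (<⇒≢ (countF-pos (f ∘ suc) fi) (sym (suc-injective one)))
... | false = cong suc (countF≡1⇒unique (f ∘ suc) one fi fj)

∣∣≡countF : ∀ {n} (S : Subset n) → ∣ S ∣ ≡ countF (lookup S)
∣∣≡countF []          = refl
∣∣≡countF (true ∷ S)  = cong suc (∣∣≡countF S)
∣∣≡countF (false ∷ S) = ∣∣≡countF S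

MeetsEveryClass : ∀ {n} → (Fin n → ℕ) → ℕ → Subset n → Set
MeetsEveryClass cls γ S = ∀ k → k < γ → ∃ λ v → v ∈ S × cls v ≡ k

dominating⇒meetsEveryClass : ∀ {n} (G : Graph n) (cls : Fin n → ℕ) γ →
  (∀ k → k < γ → ∃ λ c → cls c ≡ k × (∀ u → adj G u c ≡ true → cls u ≡ k)) →
  ∀ {S} → Dominating G S → MeetsEveryClass cls γ S
dominating⇒meetsEveryClass G cls γ centre {S} dom k k<γ with centre k k<γ
... | c , c∈k , closed with c ∈? S
...   | yes c∈S = c , c∈S , c∈k
...   | no  c∉S = let u , u∈S , uc = dom c c∉S in u , u∈S , closed u uc

module Classes {n γ} (cls : Fin n → ℕ) (cls<γ : ∀ v → cls v < γ) where

  classSize : Subset n → ℕ → ℕ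
  classSize S k = countF (λ v → lookup S v ∧ (cls v ≡ᵇ k))

  countF-≡ᵇtoℕ : ∀ {c} → c < γ → countF {γ} (λ k → c ≡ᵇ toℕ k) ≡ 1
  countF-≡ᵇtoℕ {c} c<γ = countF-single (λ k → c ≡ᵇ toℕ k) {fromℕ< c<γ}
    (subst (λ k → (c ≡ᵇ k) ≡ true) (sym (toℕ-fromℕ< c<γ)) (≡ᵇ-refl c))
    (λ k e → toℕ-injective (trans (sym (≡ᵇ-sound e)) (sym (toℕ-fromℕ< c<γ))))

  ∣∣≡Σ-classSize : ∀ S → ∣ S ∣ ≡ sumF {γ} (λ k → classSize S (toℕ k))
  ∣∣≡Σ-classSize S = begin
    ∣ S ∣                                                          ≡⟨ ∣∣≡countF S ⟩
    countF (lookup S)                                              ≡⟨ sumF-cong split ⟩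
    sumF (λ v → countF {γ} (λ k → lookup S v ∧ (cls v ≡ᵇ toℕ k)))  ≡⟨ sumF-comm indicator ⟩
    sumF {γ} (λ k → classSize S (toℕ k))                           ∎
    where
    open ≡-Reasoning
    indicator : Fin n → Fin γ → ℕ
    indicator v k = if lookup S v ∧ (cls v ≡ᵇ toℕ k) then 1 else 0
    split : ∀ v → (if lookup S v then 1 else 0) ≡
                  countF (λ (k : Fin γ) → lookup S v ∧ (cls v ≡ᵇ toℕ k))
    split v = trans (cong (λ c → if lookup S v then c else 0) (sym (countF-≡ᵇtoℕ (cls<γ v))))
                    (sym (countF-∧ (lookup S v) (λ (k : Fin γ) → cls v ≡ᵇ toℕ k)))

  module _ {S} (meets : MeetsEveryClass cls γ S) where

    classSize-pos : ∀ (k : Fin γ) → 1 ≤ classSize S (toℕ k)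
    classSize-pos k = let v , v∈S , v∈k = meets (toℕ k) (toℕ<n k) in
      countF-pos _ {v} (∧-true ([]=⇒lookup v∈S) (≡ᵇ-complete v∈k))

    meetsEveryClass⇒γ≤∣∣ : γ ≤ ∣ S ∣
    meetsEveryClass⇒γ≤∣∣ = begin
      γ                                   ≡⟨ sumF-one ⟨
      sumF {γ} (λ _ → 1)                  ≤⟨ sumF-mono-≤ classSize-pos ⟩
      sumF {γ} (λ k → classSize S (toℕ k)) ≡⟨ ∣∣≡Σ-classSize S ⟨
      ∣ S ∣                               ∎
      where open ≤-Reasoning

    meetsEveryClass⇒cls-injective : ∣ S ∣ ≡ γ →
                                    ∀ {u v} → u ∈ S → v ∈ S → cls u ≡ cls v → u ≡ v
    meetsEveryClass⇒cls-injective size {u} {v} u∈S v∈S uv =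
      countF≡1⇒unique _ classOfU-single
        (∧-true ([]=⇒lookup u∈S) (≡ᵇ-refl (cls u)))
        (∧-true ([]=⇒lookup v∈S) (≡ᵇ-complete (sym uv)))
      where
      classSize≡1 : ∀ k → classSize S (toℕ k) ≡ 1
      classSize≡1 k = sym (sumF-mono-≤-≡ classSize-pos
        (trans sumF-one (trans (sym size) (∣∣≡Σ-classSize S))) k)
      classOfU-single : classSize S (cls u) ≡ 1
      classOfU-single =
        subst (λ c → classSize S c ≡ 1) (toℕ-fromℕ< (cls<γ u)) (classSize≡1 (fromℕ< (cls<γ u)))

neighboursIn : ∀ {n} → Graph n → Subset n → Fin n → ℕ
neighboursIn G D v = countF (λ u → lookup D u ∧ adj G u v)

PerfectCode : ∀ {n} → Graph n → Subset n → Set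
PerfectCode G D = ∀ v → (if lookup D v then 1 else 0) + neighboursIn G D v ≡ 1

degSum≡Σ-neighboursIn : ∀ {n} (G : Graph n) D → degSum G D ≡ sumF (neighboursIn G D)
degSum≡Σ-neighboursIn G D =
  trans (sumF-cong (λ x → sym (countF-∧ (lookup D x) (adj G x))))
        (sumF-comm (λ x v → if lookup D x ∧ adj G x v then 1 else 0))

module _ {n} (G : Graph n) (D : Subset n) (perfect : PerfectCode G D) where

  perfectCode⇒degSum+∣∣ : degSum G D + ∣ D ∣ ≡ n
  perfectCode⇒degSum+∣∣ = begin
    degSum G D + ∣ D ∣                     ≡⟨ cong₂ _+_ (degSum≡Σ-neighboursIn G D) (∣∣≡countF D) ⟩
    sumF (neighboursIn G D) + countF (lookup D)  ≡⟨ +-comm (sumF (neighboursIn G D)) _ ⟩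
    countF (lookup D) + sumF (neighboursIn G D)  ≡⟨ sumF-+ inD (neighboursIn G D) ⟨
    sumF (λ v → inD v + neighboursIn G D v)      ≡⟨ sumF-cong perfect ⟩
    sumF {n} (λ _ → 1)                           ≡⟨ sumF-one ⟩
    n                                            ∎
    where
    open ≡-Reasoning
    inD : Fin n → ℕ
    inD v = if lookup D v then 1 else 0

  perfectCode⇒dominating : Dominating G D
  perfectCode⇒dominating v v∉D with lookup D v in e | perfect v
  ... | true  | _   = contradiction (lookup⇒[]= v D e) v∉D
  ... | false | one =
    let u , du = countF-witness _ (≤-reflexive (sym one))
        u∈D , uv = ∧-true⁻ (lookup D u) du
    in u , lookup⇒[]= u D u∈D , uv

  perfectCode⇒independent : ∀ {u v} → u ∈ D → v ∈ D → adj G u v ≢ true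
  perfectCode⇒independent {u} {v} u∈D v∈D uv =
    <⇒≢ (countF-pos _ {u} (∧-true ([]=⇒lookup u∈D) uv)) (sym none)
    where
    none : neighboursIn G D v ≡ 0
    none = suc-injective
      (subst (λ b → (if b then 1 else 0) + neighboursIn G D v ≡ 1) ([]=⇒lookup v∈D) (perfect v))

  dominating-⊆-perfectCode : ∀ {S} → Dominating G S → S ⊆ D → D ⊆ S
  dominating-⊆-perfectCode {S} dom S⊆D {v} v∈D with v ∈? S
  ... | yes v∈S = v∈S
  ... | no  v∉S = let u , u∈S , uv = dom v v∉S in
                  contradiction uv (perfectCode⇒independent (S⊆D u∈S) v∈D)

data Label : Set where
  hub link clique : ℕ → Label

class : Label → ℕ
class (hub k)    = k
class (link k)   = k
class (clique k) = k

isHub : Label → Bool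
isHub (hub _) = true
isHub _       = false

adjLabel : Label → Label → Bool
adjLabel (hub k)    (link l)   = k ≡ᵇ l
adjLabel (hub k)    (clique l) = k ≡ᵇ l
adjLabel (link k)   (hub l)    = l ≡ᵇ k
adjLabel (link k)   (clique l) = l <ᵇ k
adjLabel (clique k) (hub l)    = l ≡ᵇ k
adjLabel (clique k) (link l)   = k <ᵇ l
adjLabel (clique k) (clique l) = true
adjLabel _          _          = false

adjLabel-sym : ∀ x y → adjLabel x y ≡ adjLabel y x
adjLabel-sym (hub k)    (hub l)    = refl
adjLabel-sym (hub k)    (link l)   = refl
adjLabel-sym (hub k)    (clique l) = refl
adjLabel-sym (link k)   (hub l)    = refl
adjLabel-sym (link k)   (link l)   = refl
adjLabel-sym (link k)   (clique l) = refl
adjLabel-sym (clique k) (hub l)    = refl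
adjLabel-sym (clique k) (link l)   = refl
adjLabel-sym (clique k) (clique l) = refl

isHub⇒≡hub : ∀ x → isHub x ≡ true → x ≡ hub (class x)
isHub⇒≡hub (hub k) _ = refl

hub-adj⇒class : ∀ {k} x → adjLabel (hub k) x ≡ true → class x ≡ k
hub-adj⇒class (link l)   e = sym (≡ᵇ-sound e)
hub-adj⇒class (clique l) e = sym (≡ᵇ-sound e)

hub-adj⇒nonHub : ∀ {k} x → adjLabel (hub k) x ≡ true → isHub x ≡ false
hub-adj⇒nonHub (link l)   _ = refl
hub-adj⇒nonHub (clique l) _ = refl

nonHub⇒hub-adj : ∀ x → isHub x ≡ false → adjLabel (hub (class x)) x ≡ true
nonHub⇒hub-adj (link k)   _ = ≡ᵇ-refl k
nonHub⇒hub-adj (clique k) _ = ≡ᵇ-refl k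

adjOf : ∀ {n} → Vec Label n → Fin n → Fin n → Bool
adjOf (x ∷ L) zero    zero    = false
adjOf (x ∷ L) zero    (suc j) = adjLabel x (lookup L j)
adjOf (x ∷ L) (suc i) zero    = adjLabel (lookup L i) x
adjOf (x ∷ L) (suc i) (suc j) = adjOf L i j

adjOf-sym : ∀ {n} (L : Vec Label n) i j → adjOf L i j ≡ adjOf L j i
adjOf-sym (x ∷ L) zero    zero    = refl
adjOf-sym (x ∷ L) zero    (suc j) = adjLabel-sym x (lookup L j)
adjOf-sym (x ∷ L) (suc i) zero    = adjLabel-sym (lookup L i) x
adjOf-sym (x ∷ L) (suc i) (suc j) = adjOf-sym L i j

adjOf-irrefl : ∀ {n} (L : Vec Label n) i → adjOf L i i ≡ false
adjOf-irrefl (x ∷ L) zero    = refl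
adjOf-irrefl (x ∷ L) (suc i) = adjOf-irrefl L i

adjOf-≢ : ∀ {n} (L : Vec Label n) {i j} → i ≢ j → adjOf L i j ≡ adjLabel (lookup L i) (lookup L j)
adjOf-≢ (x ∷ L) {zero}  {zero}  i≢j = contradiction refl i≢j
adjOf-≢ (x ∷ L) {zero}  {suc j} i≢j = refl
adjOf-≢ (x ∷ L) {suc i} {zero}  i≢j = refl
adjOf-≢ (x ∷ L) {suc i} {suc j} i≢j = adjOf-≢ L (i≢j ∘ cong suc)

adjOf⇒adjLabel : ∀ {n} (L : Vec Label n) {i j} → adjOf L i j ≡ true →
                 adjLabel (lookup L i) (lookup L j) ≡ true
adjOf⇒adjLabel (x ∷ L) {zero}  {suc j} e = e
adjOf⇒adjLabel (x ∷ L) {suc i} {zero}  e = e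
adjOf⇒adjLabel (x ∷ L) {suc i} {suc j} e = adjOf⇒adjLabel L e

labelledGraph : ∀ {n} → Vec Label n → Graph n
labelledGraph L = record { adj = adjOf L ; symm = adjOf-sym L ; irrefl = adjOf-irrefl L }

module HubLabelling {n} (γ : ℕ) (L : Vec Label n)
  (class<γ : ∀ v → class (lookup L v) < γ)
  (complete : ∀ x → class x < γ → ∃ λ v → lookup L v ≡ x)
  (hubCount : countF (λ v → isHub (lookup L v)) ≡ γ) where

  G : Graph n
  G = labelledGraph L

  label : Fin n → Label
  label = lookup L

  vclass : Fin n → ℕ
  vclass = class ∘ label

  open Classes vclass class<γ

  adj-byLabel : ∀ {u v} → label u ≢ label v → adjLabel (label u) (label v) ≡ true →
                adj G u v ≡ true
  adj-byLabel ne e = trans (adjOf-≢ L (λ { refl → ne refl })) e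

  adjacentTo : ∀ {v y} → label v ≡ y → ∀ x → class x ≡ class y → y ≢ x → adjLabel y x ≡ true →
               ∃ λ w → adj G v w ≡ true
  adjacentTo {v} ℓv x same ne e =
    let w , ℓw = complete x (subst (_< γ) (trans (cong class ℓv) (sym same)) (class<γ v)) in
    w , adj-byLabel (λ vw → ne (trans (sym ℓv) (trans vw ℓw)))
                    (subst₂ (λ y z → adjLabel y z ≡ true) (sym ℓv) (sym ℓw) e)

  noIsolated : NoIsolated G
  noIsolated v with label v in ℓv
  ... | hub k    = adjacentTo ℓv (link k) refl (λ ()) (≡ᵇ-refl k)
  ... | link k   = adjacentTo ℓv (hub k)  refl (λ ()) (≡ᵇ-refl k)
  ... | clique k = adjacentTo ℓv (hub k)  refl (λ ()) (≡ᵇ-refl k)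

  centres : ∀ k → k < γ → ∃ λ c → vclass c ≡ k × (∀ u → adj G u c ≡ true → vclass u ≡ k)
  centres k k<γ = let c , ℓc = complete (hub k) k<γ in
    c , cong class ℓc , λ u uc → hub-adj⇒class (label u) (trans (adjLabel-sym (hub k) (label u))
      (subst (λ y → adjLabel (label u) y ≡ true) ℓc (adjOf⇒adjLabel L uc)))

  dominating⇒γ≤∣∣ : ∀ {S} → Dominating G S → γ ≤ ∣ S ∣
  dominating⇒γ≤∣∣ = meetsEveryClass⇒γ≤∣∣ ∘ dominating⇒meetsEveryClass G vclass γ centres

  hubs : Subset n
  hubs = map isHub L

  lookup-hubs : ∀ v → lookup hubs v ≡ isHub (label v)
  lookup-hubs v = lookup-map v isHub L

  ∣hubs∣ : ∣ hubs ∣ ≡ γ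
  ∣hubs∣ = trans (∣∣≡countF hubs)
    (trans (sumF-cong (λ v → cong (λ b → if b then 1 else 0) (lookup-hubs v))) hubCount)

  hubs-meetsEveryClass : MeetsEveryClass vclass γ hubs
  hubs-meetsEveryClass k k<γ = let c , ℓc = complete (hub k) k<γ in
    c , lookup⇒[]= c hubs (trans (lookup-hubs c) (cong isHub ℓc)) , cong class ℓc

  hubNeighbour : ∀ {u v} → lookup hubs u ≡ true → adj G u v ≡ true →
                 adjLabel (hub (vclass u)) (label v) ≡ true
  hubNeighbour {u} {v} hu uv = subst (λ y → adjLabel y (label v) ≡ true)
    (isHub⇒≡hub (label u) (trans (sym (lookup-hubs u)) hu)) (adjOf⇒adjLabel L uv)

  hub⇒noHubNeighbour : ∀ {v} → lookup hubs v ≡ true → neighboursIn G hubs v ≡ 0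
  hub⇒noHubNeighbour {v} hv = countF-none _ λ u e →
    let hu , uv = ∧-true⁻ (lookup hubs u) e in
    contradiction (trans (sym (trans (sym (lookup-hubs v)) hv))
                         (hub-adj⇒nonHub (label v) (hubNeighbour hu uv))) λ ()

  nonHub⇒oneHubNeighbour : ∀ {v} → isHub (label v) ≡ false → neighboursIn G hubs v ≡ 1
  nonHub⇒oneHubNeighbour {v} nonHub = countF-single _ {c} (∧-true c∈hubs cv) onlyC
    where
    c = proj₁ (complete (hub (vclass v)) (class<γ v))
    ℓc : label c ≡ hub (vclass v)
    ℓc = proj₂ (complete (hub (vclass v)) (class<γ v))
    c∈hubs : lookup hubs c ≡ true
    c∈hubs = trans (lookup-hubs c) (cong isHub ℓc)
    cv : adj G c v ≡ true
    cv = adj-byLabel (λ e → contradiction (trans (cong isHub (trans (sym ℓc) e)) nonHub) λ ())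
      (subst (λ y → adjLabel y (label v) ≡ true) (sym ℓc) (nonHub⇒hub-adj (label v) nonHub))
    onlyC : ∀ u → lookup hubs u ∧ adj G u v ≡ true → u ≡ c
    onlyC u e = let hu , uv = ∧-true⁻ (lookup hubs u) e in
      meetsEveryClass⇒cls-injective hubs-meetsEveryClass ∣hubs∣
        (lookup⇒[]= u hubs hu) (lookup⇒[]= c hubs c∈hubs)
        (trans (sym (hub-adj⇒class (label v) (hubNeighbour hu uv))) (sym (cong class ℓc)))

  hubs-perfect : PerfectCode G hubs
  hubs-perfect v with lookup hubs v in hv
  ... | true  = cong suc (hub⇒noHubNeighbour hv)
  ... | false = nonHub⇒oneHubNeighbour (trans (sym (lookup-hubs v)) hv)

  module MinimumDominatingSet {S} (dom : Dominating G S) (size : ∣ S ∣ ≡ γ) where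

    sameLabel : ∀ {u v} → u ∈ S → v ∈ S → vclass u ≡ vclass v → label u ≡ label v
    sameLabel u∈S v∈S = cong label ∘ meetsEveryClass⇒cls-injective
      (dominating⇒meetsEveryClass G vclass γ centres dom) size u∈S v∈S

    nonHubDominator : ∀ {u y} → u ∈ S → label u ≡ y → isHub y ≡ false →
                      ∀ x → class x ≡ class y → y ≢ x →
                      ∃ λ w → w ∈ S × isHub (label w) ≡ false × adjLabel (label w) x ≡ true
    nonHubDominator {u} u∈S ℓu nonHub x same ne
      with complete x (subst (_< γ) (trans (cong class ℓu) (sym same)) (class<γ u))
    ... | v , ℓv with v ∈? S
    ...   | yes v∈S = contradiction (trans (sym ℓu) (trans (sameLabel u∈S v∈S uv) ℓv)) ne
      where
      uv : vclass u ≡ vclass v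
      uv = trans (cong class ℓu) (trans (sym same) (sym (cong class ℓv)))
    ...   | no  v∉S with dom v v∉S
    ...     | w , w∈S , wv with isHub (label w) in hw
    ...       | false = w , w∈S , hw , subst (λ z → adjLabel (label w) z ≡ true) ℓv (adjOf⇒adjLabel L wv)
    ...       | true  =
      contradiction (trans (sym hw) (trans (cong isHub (trans (sameLabel w∈S u∈S wu) ℓu)) nonHub)) λ ()
      where
      ℓw : label w ≡ hub (vclass w)
      ℓw = isHub⇒≡hub (label w) hw
      wx : adjLabel (hub (vclass w)) x ≡ true
      wx = subst₂ (λ y z → adjLabel y z ≡ true) ℓw ℓv (adjOf⇒adjLabel L wv)
      wu : vclass w ≡ vclass u
      wu = trans (sym (hub-adj⇒class x wx)) (trans same (sym (cong class ℓu)))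

    NoClique : ℕ → Set
    NoClique j = ∀ {u} → u ∈ S → label u ≢ clique j

    noClique-step : ∀ j → (∀ {k} → k < j → NoClique k) → NoClique j
    noClique-step j below {u} u∈S ℓu
      with nonHubDominator u∈S ℓu refl (link j) refl (λ ())
    ... | w , w∈S , nonHub , wb with label w in ℓw
    ...   | hub _    = contradiction nonHub λ ()
    ...   | link _   = contradiction wb λ ()
    ...   | clique k = below (<ᵇ-sound wb) w∈S ℓw

    noClique : ∀ j → NoClique j
    noClique = <-rec NoClique noClique-step

    -- downward induction on j, with d bounding γ - j
    noLinkAbove : ∀ d j → γ ≤ j + d → ∀ {u} → u ∈ S → label u ≢ link j
    noLinkAbove zero j γ≤j {u} u∈S ℓu =
      <⇒≱ (subst (_< γ) (cong class ℓu) (class<γ u)) (subst (γ ≤_) (+-identityʳ j) γ≤j)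
    noLinkAbove (suc d) j γ≤j+d {u} u∈S ℓu
      with nonHubDominator u∈S ℓu refl (clique j) refl (λ ())
    ... | w , w∈S , nonHub , wc with label w in ℓw
    ...   | hub _    = contradiction nonHub λ ()
    ...   | link k   = noLinkAbove d k γ≤k+d w∈S ℓw
      where
      γ≤k+d : γ ≤ k + d
      γ≤k+d = ≤-trans γ≤j+d (≤-trans (≤-reflexive (+-suc j d)) (+-monoˡ-≤ d (<ᵇ-sound wc)))
    ...   | clique k = noClique k w∈S ℓw

    S⊆hubs : S ⊆ hubs
    S⊆hubs {v} v∈S = lookup⇒[]= v hubs (trans (lookup-hubs v) hubLabelled)
      where
      hubLabelled : isHub (label v) ≡ true
      hubLabelled with label v in ℓv
      ... | hub _    = refl
      ... | link j   = contradiction ℓv (noLinkAbove γ j (m≤n+m γ j) v∈S)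
      ... | clique j = contradiction ℓv (noClique j v∈S)

    S≡hubs : S ≡ hubs
    S≡hubs = ⊆-antisym S⊆hubs (dominating-⊆-perfectCode G hubs hubs-perfect dom S⊆hubs)

  hubs-dominating : Dominating G hubs
  hubs-dominating = perfectCode⇒dominating G hubs hubs-perfect

  domination-number : IsDominationNumber G γ
  domination-number = (hubs , hubs-dominating , ∣hubs∣) , λ S → dominating⇒γ≤∣∣

  inClass : InClass n γ G
  inClass = noIsolated , domination-number ,
    λ S S′ (domS , sizeS) (domS′ , sizeS′) →
      trans (MinimumDominatingSet.S≡hubs domS sizeS) (sym (MinimumDominatingSet.S≡hubs domS′ sizeS′))

  perfectlyDominated : PerfectlyDominated G
  perfectlyDominated =
    noIsolated , γ , domination-number , hubs , (hubs-dominating , ∣hubs∣) , degSum≡n∸γ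
    where
    degSum≡n∸γ : degSum G hubs ≡ n ∸ γ
    degSum≡n∸γ = trans (sym (m+n∸n≡m (degSum G hubs) γ)) (cong (_∸ γ)
      (trans (cong (degSum G hubs +_) (sym ∣hubs∣)) (perfectCode⇒degSum+∣∣ G hubs hubs-perfect)))

triple : ℕ → Vec Label 3
triple k = hub k ∷ link k ∷ clique k ∷ []

triples : (g : ℕ) → Vec Label (g * 3)
triples zero    = []
triples (suc g) = triple g ++ triples g

labelling : (m g : ℕ) → Vec Label (m + g * 3)
labelling zero    g = triples g
labelling (suc m) g = clique 0 ∷ labelling m g

triples-class< : ∀ g i → class (lookup (triples g) i) < g
triples-class< (suc g) zero                   = n<1+n g
triples-class< (suc g) (suc zero)             = n<1+n g
triples-class< (suc g) (suc (suc zero))       = n<1+n g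
triples-class< (suc g) (suc (suc (suc i)))    = m<n⇒m<1+n (triples-class< g i)

labelling-class< : ∀ m g → 0 < g → ∀ i → class (lookup (labelling m g) i) < g
labelling-class< zero    g 0<g i       = triples-class< g i
labelling-class< (suc m) g 0<g zero    = 0<g
labelling-class< (suc m) g 0<g (suc i) = labelling-class< m g 0<g i

triples-complete : ∀ g x → class x < g → ∃ λ i → lookup (triples g) i ≡ x
triples-complete (suc g) x x<1+g with m<1+n⇒m<n∨m≡n x<1+g
... | inj₁ x<g  = let i , e = triples-complete g x x<g in suc (suc (suc i)) , e
... | inj₂ refl = newest x
  where
  newest : ∀ x → ∃ λ i → lookup (triples (suc (class x))) i ≡ x
  newest (hub k)    = zero , refl
  newest (link k)   = suc zero , refl
  newest (clique k) = suc (suc zero) , refl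

labelling-complete : ∀ m g x → class x < g → ∃ λ i → lookup (labelling m g) i ≡ x
labelling-complete zero    g x x<g = triples-complete g x x<g
labelling-complete (suc m) g x x<g = let i , e = labelling-complete m g x x<g in suc i , e

labelling-hubCount : ∀ m g → countF (λ i → isHub (lookup (labelling m g) i)) ≡ g
labelling-hubCount (suc m) g       = labelling-hubCount m g
labelling-hubCount zero    zero    = refl
labelling-hubCount zero    (suc g) = cong suc (labelling-hubCount zero g)

neighbourCount : ∀ {n} → Label → Vec Label n → ℕ
neighbourCount x L = countF (λ j → adjLabel x (lookup L j))

neighbourCount-++ : ∀ {k n} x (K : Vec Label k) (L : Vec Label n) →
                    neighbourCount x (K ++ L) ≡ neighbourCount x K + neighbourCount x L
neighbourCount-++ x []      L = refl
neighbourCount-++ x (y ∷ K) L = trans (cong (ind +_) (neighbourCount-++ x K L))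
                                      (sym (+-assoc ind (neighbourCount x K) (neighbourCount x L)))
  where ind = if adjLabel x y then 1 else 0

neighbourCount-triples : ∀ x c g → (∀ k → k < g → neighbourCount x (triple k) ≡ c) →
                         neighbourCount x (triples g) ≡ g * c
neighbourCount-triples x c zero    _    = refl
neighbourCount-triples x c (suc g) each = trans (neighbourCount-++ x (triple g) (triples g))
  (cong₂ _+_ (each g (n<1+n g)) (neighbourCount-triples x c g (λ k k<g → each k (m<n⇒m<1+n k<g))))

edgeCount-∷ : ∀ {n} x (L : Vec Label n) →
              edgeCount (labelledGraph (x ∷ L)) ≡ neighbourCount x L + edgeCount (labelledGraph L)
edgeCount-∷ x L = refl

neighbourCount-hub : ∀ g → neighbourCount (hub g) (triples g) ≡ 0
neighbourCount-hub g = trans (neighbourCount-triples (hub g) 0 g each) (*-zeroʳ g)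
  where
  each : ∀ k → k < g → neighbourCount (hub g) (triple k) ≡ 0
  each k k<g rewrite ≡ᵇ-false (>⇒≢ k<g) = refl

neighbourCount-link : ∀ g → neighbourCount (link g) (triples g) ≡ g
neighbourCount-link g = trans (neighbourCount-triples (link g) 1 g each) (*-identityʳ g)
  where
  each : ∀ k → k < g → neighbourCount (link g) (triple k) ≡ 1
  each k k<g rewrite ≡ᵇ-false (<⇒≢ k<g) | <ᵇ-complete k<g = refl

neighbourCount-clique : ∀ g → neighbourCount (clique g) (triples g) ≡ g
neighbourCount-clique g = trans (neighbourCount-triples (clique g) 1 g each) (*-identityʳ g)
  where
  each : ∀ k → k < g → neighbourCount (clique g) (triple k) ≡ 1
  each k k<g rewrite ≡ᵇ-false (<⇒≢ k<g) | <ᵇ-false (<⇒≤ k<g) = refl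

neighbourCount-clique0 : ∀ m g → neighbourCount (clique 0) (labelling m g) ≡ m + g * 2
neighbourCount-clique0 (suc m) g = cong suc (neighbourCount-clique0 m g)
neighbourCount-clique0 zero    g = neighbourCount-triples (clique 0) 2 g each
  where
  each : ∀ k → k < g → neighbourCount (clique 0) (triple k) ≡ 2
  each zero    _ = refl
  each (suc k) _ = refl

edgeCount-triples-suc : ∀ g → edgeCount (labelledGraph (triples (suc g))) ≡
                              2 + (g + (g + edgeCount (labelledGraph (triples g))))
edgeCount-triples-suc g
  rewrite ≡ᵇ-refl g | <ᵇ-false (≤-refl {g})
        | neighbourCount-hub g | neighbourCount-link g | neighbourCount-clique g = refl

[1+n]C2≡n+nC2 : ∀ x → suc x C 2 ≡ x + x C 2
[1+n]C2≡n+nC2 x = sym (trans (cong (_+ x C 2) (sym (nC1≡n x))) (nCk+nC[k+1]≡[n+1]C[k+1] x 1))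

-- Both sides carry an extra g * g, so that no truncated subtraction occurs.
edgeCount+square-triples : ∀ g →
  edgeCount (labelledGraph (triples g)) + g * g ≡ (g * 2) C 2 + g * 2
edgeCount+square-triples zero    = refl
edgeCount+square-triples (suc g) = begin
    edgeCount (labelledGraph (triples (suc g))) + suc g * suc g
  ≡⟨ cong (_+ suc g * suc g) (edgeCount-triples-suc g) ⟩
    2 + (g + (g + e)) + suc g * suc g
  ≡⟨ collect g e ⟩
    (e + g * g) + (3 + g * 4)
  ≡⟨ cong (_+ (3 + g * 4)) (edgeCount+square-triples g) ⟩
    ((g * 2) C 2 + g * 2) + (3 + g * 4)
  ≡⟨ spread g ((g * 2) C 2) ⟩
    (suc (g * 2) + (g * 2 + (g * 2) C 2)) + (2 + g * 2)
  ≡⟨ cong (λ t → suc (g * 2) + t + (2 + g * 2)) ([1+n]C2≡n+nC2 (g * 2)) ⟨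
    (suc (g * 2) + suc (g * 2) C 2) + (2 + g * 2)
  ≡⟨ cong (_+ (2 + g * 2)) ([1+n]C2≡n+nC2 (suc (g * 2))) ⟨
    (suc g * 2) C 2 + suc g * 2
  ∎
  where
  open ≡-Reasoning
  e = edgeCount (labelledGraph (triples g))
  collect : ∀ g e → 2 + (g + (g + e)) + suc g * suc g ≡ (e + g * g) + (3 + g * 4)
  collect = solve-∀
  spread : ∀ g x → (x + g * 2) + (3 + g * 4) ≡ (suc (g * 2) + (g * 2 + x)) + (2 + g * 2)
  spread = solve-∀

edgeCount+square-labelling : ∀ m g →
  edgeCount (labelledGraph (labelling m g)) + g * g ≡ (m + g * 2) C 2 + g * 2
edgeCount+square-labelling zero    g = edgeCount+square-triples g
edgeCount+square-labelling (suc m) g = begin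
    edgeCount (labelledGraph (labelling (suc m) g)) + g * g
  ≡⟨ cong (_+ g * g) (edgeCount-∷ (clique 0) (labelling m g)) ⟩
    (neighbourCount (clique 0) (labelling m g) + e) + g * g
  ≡⟨ cong (λ t → t + e + g * g) (neighbourCount-clique0 m g) ⟩
    (d + e) + g * g
  ≡⟨ +-assoc d e (g * g) ⟩
    d + (e + g * g)
  ≡⟨ cong (d +_) (edgeCount+square-labelling m g) ⟩
    d + (d C 2 + g * 2)
  ≡⟨ +-assoc d (d C 2) (g * 2) ⟨
    (d + d C 2) + g * 2
  ≡⟨ cong (_+ g * 2) ([1+n]C2≡n+nC2 d) ⟨
    suc d C 2 + g * 2
  ∎
  where
  open ≡-Reasoning
  d = m + g * 2
  e = edgeCount (labelledGraph (labelling m g))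

edgeCount-labelling : ∀ m γ → 2 ≤ γ →
  edgeCount (labelledGraph (labelling m γ)) ≡ ((m + γ * 3) ∸ γ) C 2 ∸ γ * (γ ∸ 2)
edgeCount-labelling m γ@(suc (suc g)) (s≤s (s≤s z≤n)) = begin
    e
  ≡⟨ m+n∸n≡m e (γ * g) ⟨
    (e + γ * g) ∸ γ * g
  ≡⟨ cong (_∸ γ * g) (+-cancelʳ-≡ (γ * 2) _ _ (trans (sym (square g e)) (edgeCount+square-labelling m γ))) ⟩
    (m + γ * 2) C 2 ∸ γ * g
  ≡⟨ cong (λ t → t C 2 ∸ γ * g) nonHubs ⟨
    ((m + γ * 3) ∸ γ) C 2 ∸ γ * g
  ∎
  where
  open ≡-Reasoning
  e = edgeCount (labelledGraph (labelling m γ))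
  square : ∀ g e → e + (2 + g) * (2 + g) ≡ e + (2 + g) * g + (2 + g) * 2
  square = solve-∀
  split : ∀ m γ → m + γ * 3 ≡ m + γ * 2 + γ
  split = solve-∀
  nonHubs : (m + γ * 3) ∸ γ ≡ m + γ * 2
  nonHubs = trans (cong (_∸ γ) (split m γ)) (m+n∸n≡m (m + γ * 2) γ)

n∸3γ+γ*3≡n : ∀ n γ → 3 * γ ≤ n → (n ∸ 3 * γ) + γ * 3 ≡ n
n∸3γ+γ*3≡n n γ 3γ≤n = trans (cong (n ∸ 3 * γ +_) (*-comm γ 3)) (m∸n+n≡m 3γ≤n)

theorem2p12 : (n γ : ℕ) → 2 ≤ γ → 3 * γ ≤ n →
    Σ (Graph n) (λ G → InClass n γ G × PerfectlyDominated G ×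
    edgeCount G ≡ ((n ∸ γ) C 2) ∸ γ * (γ ∸ 2))
theorem2p12 n γ 2≤γ 3γ≤n rewrite sym (n∸3γ+γ*3≡n n γ 3γ≤n) =
  G , inClass , perfectlyDominated , edgeCount-labelling m γ 2≤γ
  where
  m = n ∸ 3 * γ
  open HubLabelling γ (labelling m γ) (labelling-class< m γ (<-≤-trans (s≤s z≤n) 2≤γ))
                      (labelling-complete m γ) (labelling-hubCount m γ)
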